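{- Let $M$ be a semi-simple perfect matching in $CGG(2m)$. Then: (1) If $e$ is an interior edge in $M$, then $M$ contains a boundary edge of $P$ lying in each of the two open half-planes determined by the line $\mathrm{aff}(e)$. (2) If $e_1,e_2$ are two crossing edges of $M$ (i.e. edges which intersect in an interior point), then $M$ contains a boundary edge of $P$ lying in each of the four open quadrants determined by the lines $\mathrm{aff}(e_1)$ and $\mathrm{aff}(e_2)$.
   Context: $CGG(2m)$ denotes the complete convex geometric graph on $2m$ vertices: its vertex set is the vertex set of a convex $2m$-gon $P$ in the plane, labelled cyclically $0,1,\dots,2m-1$, and its edges are all closed straight-line segments joining pairs of vertices. The order of an edge $[i,j]$ is $\min(|j-i|,2m-|j-i|)$. Boundary edges are the edges of $P$ (order $1$); all other edges (diagonals of $P$) are called interior edges. $\mathrm{aff}(e)$ denotes the straight line containing the segment $e$. A perfect matching is a set of $m$ edges such that every vertex lies in exactly one of them. Two edges $e,e'$ are neighbors if at least one endpoint of $e$ is adjacent on the boundary of $P$ to at least one endpoint of $e'$. Two edges cross if they intersect in a point interior to both. A perfect matching $M$ is semi-simple if all edges of $M$ have odd order and $M$ does not contain a pair of crossing neighbors. -}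

module Defs where

open import Data.Nat using (ℕ; zero; suc; _+_; _*_; _∸_; _<_; _≤_; ∣_-_∣; _⊓_)
open import Data.Fin using (Fin; toℕ)
open import Data.Bool using (Bool; true; false)
open import Data.Product using (_×_; ∃)
open import Data.Sum using (_⊎_)
open import Relation.Binary.PropositionalEquality using (_≡_; _≢_)
open import Relation.Nullary using (¬_)

-- Vertices of the convex 2m-gon P, labelled cyclically 0,1,...,2m-1
-- (counterclockwise).
V : ℕ → Set
V m = Fin (2 * m)

order : (m : ℕ) → V m → V m → ℕ
order m i j = ∣ toℕ i - toℕ j ∣ ⊓ (2 * m ∸ ∣ toℕ i - toℕ j ∣)

Odd : ℕ → Set
Odd k = ∃ λ t → k ≡ suc (2 * t)

IsBoundary : (m : ℕ) → V m → V m → Set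
IsBoundary m i j = order m i j ≡ 1

IsInterior : (m : ℕ) → V m → V m → Set
IsInterior m i j = 2 ≤ order m i j

Succ : (m : ℕ) → V m → V m → Set
Succ m i j = (suc (toℕ i) ≡ toℕ j) ⊎ (suc (toℕ i) ≡ 2 * m × toℕ j ≡ 0)

Adjacent : (m : ℕ) → V m → V m → Set
Adjacent m i j = Succ m i j ⊎ Succ m j i

-- x lies on the open boundary arc going counterclockwise from a to b
-- (strictly between a and b, endpoints excluded).
InArc : (m : ℕ) → V m → V m → V m → Set
InArc m a b x =
  (toℕ a < toℕ x × toℕ x < toℕ b) ⊎
  (toℕ b < toℕ a × (toℕ a < toℕ x ⊎ toℕ x < toℕ b))

-- Since the vertices are in convex position, a vertex x lies in one of the
-- two open half-planes bounded by aff([a,b]) iff it lies on the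
-- corresponding open arc; the two half-planes are indexed by a Bool.
Side : (m : ℕ) → V m → V m → Bool → V m → Set
Side m a b true  x = InArc m a b x
Side m a b false x = InArc m b a x

-- A (closed) segment [x,y] lies in an open half-plane iff both endpoints do.
SegInSide : (m : ℕ) → V m → V m → Bool → V m → V m → Set
SegInSide m a b σ x y = Side m a b σ x × Side m a b σ y

-- [a,b] and [c,d] cross (meet in a point interior to both): for vertices in
-- convex position, this means the endpoints strictly interleave cyclically.
Cross : (m : ℕ) → V m → V m → V m → V m → Set
Cross m a b c d =
  (InArc m a b c × InArc m b a d) ⊎ (InArc m b a c × InArc m a b d)

Neighbors : (m : ℕ) → V m → V m → V m → V m → Set
Neighbors m a b c d =
  Adjacent m a c ⊎ Adjacent m a d ⊎ Adjacent m b c ⊎ Adjacent m b d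

-- A perfect matching of CGG(2m), encoded by its partner map: the edges of
-- M are the segments [i, p i]; every vertex lies in exactly one edge.
record PerfectMatching (m : ℕ) : Set where
  field
    partner    : V m → V m
    involutive : ∀ i → partner (partner i) ≡ i
    noFixed    : ∀ i → partner i ≢ i
open PerfectMatching public

SemiSimple : (m : ℕ) → PerfectMatching m → Set
SemiSimple m M =
  (∀ i → Odd (order m i (partner M i))) ×
  (∀ i j → Cross m i (partner M i) j (partner M j) →
           ¬ Neighbors m i (partner M i) j (partner M j))

{-# OPTIONS --safe #-}
-- Relabelling the vertices so that an endpoint of the relevant edge becomes 0 turns the
-- arcs of the polygon into intervals of ℕ. If [x, y] is an edge with x + 1 < y, the edge
-- at x + 1 is a neighbour of [x, y], so it does not cross it and is nested inside it;
-- walking inwards along these nested edges ends at an edge [k, k + 1], a boundary edge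
-- inside the arc. For crossing edges [0, x] and [y, y′] with 0 < y < x < y′, the edge at 1
-- is nested in [0, x]: either it ends before y, and the first walk applies, or it crosses
-- [y, y′] just as [0, x] does, and the argument repeats from 1. Each quadrant is the arc
-- between two cyclically consecutive endpoints, so centring at each endpoint in turn covers
-- all four.
module Submission where

open import Defs
open import Data.Nat
open import Data.Nat.Properties
open import Data.Nat.DivMod using (_%_; m%n<n; m<n⇒m%n≡m; n%n≡0; [m+n]%n≡m%n; %-distribˡ-+; m%n%n≡m%n)
open import Data.Nat.Induction using (<-wellFounded)
open import Induction.WellFounded using (Acc; acc)
open import Data.Fin using (toℕ; fromℕ<)
open import Data.Fin.Properties using (toℕ-fromℕ<; toℕ<n; toℕ-injective)
open import Data.Bool using (Bool; true; false)
open import Data.Product using (_×_; _,_; ∃; proj₁; proj₂; map₂; swap)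
open import Data.Sum using (_⊎_; inj₁; inj₂)
open import Data.Empty using (⊥-elim)
open import Relation.Binary using (Tri; tri<; tri≈; tri>)
open import Relation.Binary.PropositionalEquality
open import Relation.Nullary using (¬_; yes; no)
open import Function using (_∘_)

Between : ℕ → ℕ → ℕ → Set
Between a b x = (a < x × x < b) ⊎ (b < a × (a < x ⊎ x < b))

Crossing : ℕ → ℕ → ℕ → ℕ → Set
Crossing a b c d = (Between a b c × Between b a d) ⊎ (Between b a c × Between a b d)

-- Between a c b says that a, b, c occur in this cyclic order.
between-rotate : ∀ {a b c} → Between a c b → Between b a c
between-rotate (inj₁ (a<b , b<c))          = inj₂ (a<b , inj₁ b<c)
between-rotate (inj₂ (c<a , inj₁ a<b))     = inj₂ (a<b , inj₂ c<a)
between-rotate (inj₂ (c<a , inj₂ b<c))     = inj₁ (b<c , c<a)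

between-from-zero : ∀ {b x} → Between 0 b x → 0 < x × x < b
between-from-zero (inj₁ 0<x<b) = 0<x<b

between-to-zero : ∀ {a x} → Between a 0 x → a < x
between-to-zero (inj₂ (_ , inj₁ a<x)) = a<x

between-cong : ∀ {a a′ b b′ x x′} → a ≡ a′ → b ≡ b′ → x ≡ x′ → Between a b x → Between a′ b′ x′
between-cong refl refl refl h = h

edge-between : ∀ {a b k} → a < k → suc k < b → Between a b k × Between a b (suc k)
edge-between a<k sk<b = inj₁ (a<k , <-trans (n<1+n _) sk<b) , inj₁ (<-trans a<k (n<1+n _) , sk<b)

edge-before : ∀ {a b k} → suc k < b → b < a → Between a b k × Between a b (suc k)
edge-before sk<b b<a = inj₂ (b<a , inj₂ (<-trans (n<1+n _) sk<b)) , inj₂ (b<a , inj₂ sk<b)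

crossing-swap : ∀ {a a′ b b′} → Between a a′ b → Between a′ a b′ →
                Between b b′ a′ × Between b′ b a
crossing-swap (inj₁ (a<b , b<a′)) (inj₁ (a′<b′ , b′<a)) = ⊥-elim (<-asym (<-trans a<b b<a′) (<-trans a′<b′ b′<a))
crossing-swap (inj₁ (a<b , b<a′)) (inj₂ (_ , inj₁ a′<b′)) = inj₁ (b<a′ , a′<b′) , inj₂ (<-trans b<a′ a′<b′ , inj₂ a<b)
crossing-swap (inj₁ (a<b , b<a′)) (inj₂ (_ , inj₂ b′<a)) = inj₂ (<-trans b′<a a<b , inj₁ b<a′) , inj₁ (b′<a , a<b)
crossing-swap (inj₂ (a′<a , inj₁ a<b)) (inj₁ (a′<b′ , b′<a)) = inj₂ (<-trans b′<a a<b , inj₂ a′<b′) , inj₁ (b′<a , a<b)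
crossing-swap (inj₂ (a′<a , inj₂ b<a′)) (inj₁ (a′<b′ , b′<a)) = inj₁ (b<a′ , a′<b′) , inj₂ (<-trans b<a′ a′<b′ , inj₁ b′<a)
crossing-swap (inj₂ (a′<a , _)) (inj₂ (a<a′ , _)) = ⊥-elim (<-asym a′<a a<a′)

[m%n+k]%n≡[m+k]%n : ∀ m k n .{{_ : NonZero n}} → (m % n + k) % n ≡ (m + k) % n
[m%n+k]%n≡[m+k]%n m k n = begin
  (m % n + k) % n           ≡⟨ %-distribˡ-+ (m % n) k n ⟩
  (m % n % n + k % n) % n   ≡⟨ cong (λ t → (t + k % n) % n) (m%n%n≡m%n m n) ⟩
  (m % n + k % n) % n       ≡⟨ %-distribˡ-+ m k n ⟨
  (m + k) % n               ∎
  where open ≡-Reasoning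

suc%≡⇒succ : ∀ {a b n} .{{_ : NonZero n}} → a < n → suc a % n ≡ b →
             (suc a ≡ b) ⊎ (suc a ≡ n × b ≡ 0)
suc%≡⇒succ {a} {n = n} a<n e with m≤n⇒m<n∨m≡n a<n
... | inj₁ sa<n = inj₁ (trans (sym (m<n⇒m%n≡m sa<n)) e)
... | inj₂ sa≡n = inj₂ (sa≡n , trans (sym e) (trans (cong (_% n) sa≡n) (n%n≡0 n)))

rotate-rotate : ∀ n .{{_ : NonZero n}} {s t} → s + t ≡ n → ∀ x → ((x + s) % n + t) % n ≡ x % n
rotate-rotate n {s} {t} s+t≡n x = begin
  ((x + s) % n + t) % n   ≡⟨ [m%n+k]%n≡[m+k]%n (x + s) t n ⟩
  (x + s + t) % n         ≡⟨ cong (_% n) (trans (+-assoc x s t) (cong (x +_) s+t≡n)) ⟩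
  (x + n) % n             ≡⟨ [m+n]%n≡m%n x n ⟩
  x % n                   ∎
  where open ≡-Reasoning

rotate-suc-rotate : ∀ n .{{_ : NonZero n}} {s t} → s + t ≡ n → ∀ x → (suc ((x + s) % n) + t) % n ≡ suc x % n
rotate-suc-rotate n {s} {t} s+t≡n x = begin
  (suc ((x + s) % n) + t) % n   ≡⟨ cong (_% n) (sym (+-suc ((x + s) % n) t)) ⟩
  ((x + s) % n + suc t) % n     ≡⟨ [m%n+k]%n≡[m+k]%n (x + s) (suc t) n ⟩
  (x + s + suc t) % n           ≡⟨ cong (_% n) (trans (+-suc (x + s) t) (cong suc (+-assoc x s t))) ⟩
  (suc x + (s + t)) % n         ≡⟨ cong (λ u → (suc x + u) % n) s+t≡n ⟩
  (suc x + n) % n               ≡⟨ [m+n]%n≡m%n (suc x) n ⟩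
  suc x % n                     ∎
  where open ≡-Reasoning

-- Rotation by t of the positions 0, …, n-1: those from c on wrap around to 0.
module Rotation (n : ℕ) .{{_ : NonZero n}} (c t : ℕ) (c+t≡n : c + t ≡ n) where

  rotate : ℕ → ℕ
  rotate x = (x + t) % n

  rotate-below : ∀ {x} → x < c → rotate x ≡ x + t
  rotate-below {x} x<c = m<n⇒m%n≡m (subst (x + t <_) c+t≡n (+-monoˡ-< t x<c))

  rotate-above : ∀ {x} → c ≤ x → x < n → rotate x ≡ x ∸ c
  rotate-above {x} c≤x x<n = begin
    (x + t) % n          ≡⟨ cong (λ u → (u + t) % n) (sym (m∸n+n≡m c≤x)) ⟩
    (x ∸ c + c + t) % n  ≡⟨ cong (_% n) (trans (+-assoc (x ∸ c) c t) (cong (x ∸ c +_) c+t≡n)) ⟩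
    (x ∸ c + n) % n      ≡⟨ [m+n]%n≡m%n (x ∸ c) n ⟩
    (x ∸ c) % n          ≡⟨ m<n⇒m%n≡m (≤-<-trans (m∸n≤m x c) x<n) ⟩
    x ∸ c                ∎
    where open ≡-Reasoning

  rotate-mono-below : ∀ {x y} → x < y → y < c → rotate x < rotate y
  rotate-mono-below {x} {y} x<y y<c
    rewrite rotate-below (<-trans x<y y<c) | rotate-below y<c = +-monoˡ-< t x<y

  rotate-mono-above : ∀ {x y} → c ≤ x → x < y → y < n → rotate x < rotate y
  rotate-mono-above {x} {y} c≤x x<y y<n
    rewrite rotate-above c≤x (<-trans x<y y<n) | rotate-above (≤-trans c≤x (<⇒≤ x<y)) y<n =
      ∸-monoˡ-< x<y c≤x

  rotate-wraps : ∀ {x y} → x < c → c ≤ y → y < n → rotate y < rotate x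
  rotate-wraps {x} {y} x<c c≤y y<n rewrite rotate-below x<c | rotate-above c≤y y<n =
    <-≤-trans (subst (y ∸ c <_) (trans (cong (_∸ c) (sym c+t≡n)) (m+n∸m≡n c t)) (∸-monoˡ-< y<n c≤y))
              (m≤n+m t x)

  rotate-ordered : ∀ {x y z} → x < y → y < z → z < n → Between (rotate x) (rotate z) (rotate y)
  rotate-ordered {x} {y} {z} x<y y<z z<n with c ≤? x | c ≤? y | c ≤? z
  ... | yes c≤x | _ | _ =
    inj₁ (rotate-mono-above c≤x x<y (<-trans y<z z<n) ,
          rotate-mono-above (≤-trans c≤x (<⇒≤ x<y)) y<z z<n)
  ... | no c≰x | yes c≤y | _ =
    inj₂ (rotate-wraps (≰⇒> c≰x) (≤-trans c≤y (<⇒≤ y<z)) z<n , inj₂ (rotate-mono-above c≤y y<z z<n))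
  ... | no c≰x | no c≰y | yes c≤z =
    inj₂ (rotate-wraps (≰⇒> c≰x) c≤z z<n , inj₁ (rotate-mono-below x<y (≰⇒> c≰y)))
  ... | no _ | no _ | no c≰z =
    inj₁ (rotate-mono-below x<y (<-trans y<z (≰⇒> c≰z)) , rotate-mono-below y<z (≰⇒> c≰z))

  rotate-between : ∀ {a b x} → a < n → b < n → x < n →
                   Between a b x → Between (rotate a) (rotate b) (rotate x)
  rotate-between a<n b<n x<n (inj₁ (a<x , x<b))       = rotate-ordered a<x x<b b<n
  rotate-between a<n b<n x<n (inj₂ (b<a , inj₁ a<x))  = between-rotate (rotate-ordered b<a a<x x<n)
  rotate-between a<n b<n x<n (inj₂ (b<a , inj₂ x<b))  =
    between-rotate (between-rotate (rotate-ordered x<b b<a a<n))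

module NestedEdges (n : ℕ) (q : ℕ → ℕ)
  (q<n : ∀ x → q x < n)
  (q-involutive : ∀ {x} → x < n → q (q x) ≡ x)
  (q-fixed-point-free : ∀ {x} → x < n → q x ≢ x)
  (consecutive-uncrossed : ∀ {x} → suc x < n → ¬ Crossing x (q x) (suc x) (q (suc x)))
  where

  BoundaryWithin : ℕ → ℕ → Set
  BoundaryWithin x y = ∃ λ k → x ≤ k × suc k ≤ y × q k ≡ suc k

  BoundaryBetween : ℕ → ℕ → Set
  BoundaryBetween x y = ∃ λ k → x < k × suc k < y × q k ≡ suc k

  next-nested : ∀ {x} → suc x < q x → suc x < q (suc x) × q (suc x) < q x
  next-nested {x} sx<qx =
    ≤∧≢⇒< (after-x (<-cmp z x)) (λ sx≡z → q-fixed-point-free sx<n (sym sx≡z)) ,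
    before-qx (<-cmp z (q x))
    where
    z : ℕ
    z = q (suc x)
    x<qx : x < q x
    x<qx = <-trans (n<1+n x) sx<qx
    sx<n : suc x < n
    sx<n = <-trans sx<qx (q<n x)
    x<n : x < n
    x<n = <-trans (n<1+n x) sx<n
    after-x : Tri (z < x) (z ≡ x) (x < z) → x < z
    after-x (tri< z<x _ _) =
      ⊥-elim (consecutive-uncrossed sx<n (inj₁ (inj₁ (n<1+n x , sx<qx) , inj₂ (x<qx , inj₂ z<x))))
    after-x (tri≈ _ z≡x _) =
      ⊥-elim (<-irrefl (sym (trans (cong q (sym z≡x)) (q-involutive sx<n))) sx<qx)
    after-x (tri> _ _ x<z) = x<z
    before-qx : Tri (z < q x) (z ≡ q x) (q x < z) → z < q x
    before-qx (tri< z<qx _ _) = z<qx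
    before-qx (tri≈ _ z≡qx _) =
      ⊥-elim (<-irrefl (trans (sym (q-involutive x<n)) (trans (cong q (sym z≡qx)) (q-involutive sx<n)))
                       (n<1+n x))
    before-qx (tri> _ _ qx<z) =
      ⊥-elim (consecutive-uncrossed sx<n (inj₁ (inj₁ (n<1+n x , sx<qx) , inj₂ (x<qx , inj₁ qx<z))))

  n∸suc<n∸ : ∀ {x y} → x < q y → n ∸ suc x < n ∸ x
  n∸suc<n∸ {x} {y} x<qy = ∸-monoʳ-< (n<1+n x) (<-trans x<qy (q<n y))

  boundary-within : ∀ {x} → x < q x → BoundaryWithin x (q x)
  boundary-within = walk (<-wellFounded _)
    where
    walk : ∀ {x} → Acc _<_ (n ∸ x) → x < q x → BoundaryWithin x (q x)
    walk {x} (acc rec) x<qx with q x ≟ suc x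
    ... | yes qx≡sx = x , ≤-refl , ≤-reflexive (sym qx≡sx) , qx≡sx
    ... | no qx≢sx with next-nested (≤∧≢⇒< x<qx (qx≢sx ∘ sym))
    ...   | sx<z , z<qx with walk (rec (n∸suc<n∸ x<qx)) sx<z
    ...     | k , x<k , sk≤z , qk≡sk = k , <⇒≤ x<k , ≤-trans sk≤z (<⇒≤ z<qx) , qk≡sk

  boundary-inside : ∀ {x} → suc x < q x → BoundaryBetween x (q x)
  boundary-inside sx<qx with next-nested sx<qx
  ... | sx<z , z<qx with boundary-within sx<z
  ...   | k , x<k , sk≤z , qk≡sk = k , x<k , ≤-<-trans sk≤z z<qx , qk≡sk

  boundary-before : ∀ {x y} → x < y → y < q x → q x < q y → BoundaryBetween x y
  boundary-before = walk (<-wellFounded _)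
    where
    walk : ∀ {x y} → Acc _<_ (n ∸ x) → x < y → y < q x → q x < q y → BoundaryBetween x y
    walk {x} {y} (acc rec) x<y y<qx qx<qy = continue (<-cmp z y)
      where
      z : ℕ
      z = q (suc x)
      sx<qx : suc x < q x
      sx<qx = ≤-<-trans x<y y<qx
      sx<z : suc x < z
      sx<z = proj₁ (next-nested sx<qx)
      z<qy : z < q y
      z<qy = <-trans (proj₂ (next-nested sx<qx)) qx<qy
      sx<y : suc x < y
      sx<y = ≤∧≢⇒< x<y (λ sx≡y → <-irrefl (cong q sx≡y) z<qy)
      continue : Tri (z < y) (z ≡ y) (y < z) → BoundaryBetween x y
      continue (tri< z<y _ _) with boundary-within sx<z
      ... | k , x<k , sk≤z , qk≡sk = k , x<k , ≤-<-trans sk≤z z<y , qk≡sk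
      continue (tri≈ _ z≡y _) =
        ⊥-elim (<-asym sx<qx (subst (q x <_) qy≡sx qx<qy))
        where
        qy≡sx : q y ≡ suc x
        qy≡sx = trans (cong q (sym z≡y)) (q-involutive (<-trans sx<qx (q<n x)))
      continue (tri> _ _ y<z) with walk (rec (n∸suc<n∸ (<-trans x<y y<qx))) sx<y y<z z<qy
      ... | k , sx<k , sk<y , qk≡sk = k , <-trans (n<1+n x) sx<k , sk<y , qk≡sk

order-of-succ : ∀ {n a b} → 2 ≤ n → (suc a ≡ b) ⊎ (suc a ≡ n × b ≡ 0) → ∣ a - b ∣ ⊓ (n ∸ ∣ a - b ∣) ≡ 1
order-of-succ {n} {a} 2≤n (inj₁ refl)
  rewrite m≤n⇒∣m-n∣≡n∸m (n≤1+n a) | m+n∸n≡m 1 a = m≤n⇒m⊓n≡m (∸-monoˡ-≤ 1 2≤n)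
order-of-succ {a = a} 2≤n (inj₂ (refl , refl))
  rewrite ∣-∣-comm a 0 | m+n∸n≡m 1 a = m≥n⇒m⊓n≡n (s≤s⁻¹ 2≤n)

adjacent⇒boundary : ∀ {m} .{{_ : NonZero m}} {a b : V m} → Adjacent m a b → IsBoundary m a b
adjacent⇒boundary {m} (inj₁ a→b) = order-of-succ (*-monoʳ-≤ 2 (>-nonZero⁻¹ m)) a→b
adjacent⇒boundary {m} {a} {b} (inj₂ b→a)
  rewrite ∣-∣-comm (toℕ a) (toℕ b) = order-of-succ (*-monoʳ-≤ 2 (>-nonZero⁻¹ m)) b→a

interior⇒¬adjacent : ∀ {m} .{{_ : NonZero m}} {a b : V m} → IsInterior m a b → ¬ Adjacent m a b
interior⇒¬adjacent interior adjacent = <-irrefl refl (subst (2 ≤_) (adjacent⇒boundary adjacent) interior)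

module Matching {m : ℕ} .{{_ : NonZero m}} (M : PerfectMatching m) (semi-simple : SemiSimple m M) where

  p : V m → V m
  p = partner M

  n : ℕ
  n = 2 * m

  instance
    n-nonZero : NonZero n
    n-nonZero = m*n≢0 2 m

  partner-of : ∀ {a a′} → p a ≡ a′ → p a′ ≡ a
  partner-of {a} refl = involutive M a

  module Centred (c : V m) where

    private
      c<n : toℕ c < n
      c<n = toℕ<n c
      c+t≡n : toℕ c + (n ∸ toℕ c) ≡ n
      c+t≡n = m+[n∸m]≡n (<⇒≤ c<n)
      t+c≡n : n ∸ toℕ c + toℕ c ≡ n
      t+c≡n = m∸n+n≡m (<⇒≤ c<n)
      module Forward = Rotation n (toℕ c) (n ∸ toℕ c) c+t≡n
      module Backward = Rotation n (n ∸ toℕ c) (toℕ c) t+c≡n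

    pos : V m → ℕ
    pos x = Forward.rotate (toℕ x)

    vertex : ℕ → V m
    vertex v = fromℕ< (m%n<n (v + toℕ c) n)

    backward-forward : ∀ {x} → x < n → Backward.rotate (Forward.rotate x) ≡ x
    backward-forward {x} x<n = trans (rotate-rotate n t+c≡n x) (m<n⇒m%n≡m x<n)

    pos-vertex : ∀ {v} → v < n → pos (vertex v) ≡ v
    pos-vertex {v} v<n =
      trans (cong Forward.rotate (toℕ-fromℕ< (m%n<n (v + toℕ c) n)))
            (trans (rotate-rotate n c+t≡n v) (m<n⇒m%n≡m v<n))

    vertex-pos : ∀ x → vertex (pos x) ≡ x
    vertex-pos x = toℕ-injective (trans (toℕ-fromℕ< (m%n<n (pos x + toℕ c) n)) (backward-forward (toℕ<n x)))

    pos-injective : ∀ {x y} → pos x ≡ pos y → x ≡ y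
    pos-injective {x} {y} e = trans (sym (vertex-pos x)) (trans (cong vertex e) (vertex-pos y))

    pos-centre : pos c ≡ 0
    pos-centre = trans (Forward.rotate-above ≤-refl c<n) (n∸n≡0 (toℕ c))

    vertex-origin : vertex 0 ≡ c
    vertex-origin = pos-injective (trans (pos-vertex (>-nonZero⁻¹ n)) (sym pos-centre))

    pos<n : ∀ x → pos x < n
    pos<n x = m%n<n (toℕ x + (n ∸ toℕ c)) n

    inArc⇒between : ∀ {a b x} → InArc m a b x → Between (pos a) (pos b) (pos x)
    inArc⇒between {a} {b} {x} = Forward.rotate-between (toℕ<n a) (toℕ<n b) (toℕ<n x)

    between⇒inArc : ∀ {a b x} → Between (pos a) (pos b) (pos x) → InArc m a b x
    between⇒inArc {a} {b} {x} h =
      between-cong (backward-forward (toℕ<n a)) (backward-forward (toℕ<n b)) (backward-forward (toℕ<n x))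
                   (Backward.rotate-between (pos<n a) (pos<n b) (pos<n x) h)

    inArc-at : ∀ {a b x i j k} → pos a ≡ i → pos b ≡ j → pos x ≡ k → Between i j k → InArc m a b x
    inArc-at refl refl refl = between⇒inArc

    succ-at : ∀ {a b} → suc (pos a) ≡ pos b → Succ m a b
    succ-at {a} {b} e = suc%≡⇒succ (toℕ<n a) (sym (begin
      toℕ b                          ≡⟨ backward-forward (toℕ<n b) ⟨
      Backward.rotate (pos b)        ≡⟨ cong Backward.rotate e ⟨
      Backward.rotate (suc (pos a))  ≡⟨ rotate-suc-rotate n t+c≡n (toℕ a) ⟩
      suc (toℕ a) % n                ∎))
      where open ≡-Reasoning

    q : ℕ → ℕ
    q v = pos (p (vertex v))

    q<n : ∀ v → q v < n
    q<n v = pos<n (p (vertex v))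

    q-pos : ∀ x → q (pos x) ≡ pos (p x)
    q-pos x = cong (pos ∘ p) (vertex-pos x)

    q-involutive : ∀ {v} → v < n → q (q v) ≡ v
    q-involutive {v} v<n = begin
      q (pos (p (vertex v)))  ≡⟨ q-pos (p (vertex v)) ⟩
      pos (p (p (vertex v)))  ≡⟨ cong pos (involutive M (vertex v)) ⟩
      pos (vertex v)          ≡⟨ pos-vertex v<n ⟩
      v                       ∎
      where open ≡-Reasoning

    q-fixed-point-free : ∀ {v} → v < n → q v ≢ v
    q-fixed-point-free v<n e = noFixed M _ (pos-injective (trans e (sym (pos-vertex v<n))))

    consecutive-uncrossed : ∀ {v} → suc v < n → ¬ Crossing v (q v) (suc v) (q (suc v))
    consecutive-uncrossed {v} sv<n crossing =
      proj₂ semi-simple (vertex v) (vertex (suc v))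
        (cross-at crossing) (inj₁ (inj₁ (succ-at (trans (cong suc (pos-vertex v<n)) (sym (pos-vertex sv<n))))))
      where
      v<n : v < n
      v<n = <-trans (n<1+n v) sv<n
      cross-at : Crossing v (q v) (suc v) (q (suc v)) →
                 Cross m (vertex v) (p (vertex v)) (vertex (suc v)) (p (vertex (suc v)))
      cross-at (inj₁ (h₁ , h₂)) =
        inj₁ (inArc-at (pos-vertex v<n) refl (pos-vertex sv<n) h₁ , inArc-at refl (pos-vertex v<n) refl h₂)
      cross-at (inj₂ (h₁ , h₂)) =
        inj₂ (inArc-at refl (pos-vertex v<n) (pos-vertex sv<n) h₁ , inArc-at (pos-vertex v<n) refl refl h₂)

    open NestedEdges n q q<n q-involutive q-fixed-point-free consecutive-uncrossed

    boundary-at : ∀ {k} → k < n → q k ≡ suc k → IsBoundary m (vertex k) (p (vertex k))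
    boundary-at k<n qk≡sk = adjacent⇒boundary (inj₁ (succ-at (trans (cong suc (pos-vertex k<n)) (sym qk≡sk))))

    segment-at : ∀ {a b i j k} → pos a ≡ i → pos b ≡ j → k < n → q k ≡ suc k →
                 Between i j k × Between i j (suc k) → SegInSide m a b true (vertex k) (p (vertex k))
    segment-at ea eb k<n qk≡sk (hk , hsk) = inArc-at ea eb (pos-vertex k<n) hk , inArc-at ea eb qk≡sk hsk

    q-origin : q 0 ≡ pos (p c)
    q-origin = cong (pos ∘ p) vertex-origin

    boundary-beside : ∀ {c′} → p c ≡ c′ → ¬ Succ m c c′ →
                      ∃ λ K → IsBoundary m K (p K) × SegInSide m c c′ true K (p K)
    boundary-beside refl not-succ = found (boundary-inside 1<q0)
      where
      0<q0 : 0 < q 0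
      0<q0 = n≢0⇒n>0 (q-fixed-point-free (>-nonZero⁻¹ n))
      1<q0 : 1 < q 0
      1<q0 = ≤∧≢⇒< 0<q0 (λ 1≡q0 → not-succ (succ-at (trans (cong suc pos-centre) (trans 1≡q0 q-origin))))
      found : BoundaryBetween 0 (q 0) → ∃ λ K → IsBoundary m K (p K) × SegInSide m c (p c) true K (p K)
      found (k , 0<k , sk<q0 , qk≡sk) =
        vertex k , boundary-at k<n qk≡sk ,
        segment-at pos-centre refl k<n qk≡sk (edge-between 0<k (subst (suc k <_) q-origin sk<q0))
        where
        k<n : k < n
        k<n = <-trans (n<1+n k) (<-trans sk<q0 (q<n 0))

    boundary-in-quadrant : ∀ {x y y′} → p c ≡ x → p y ≡ y′ → InArc m c x y → InArc m x c y′ →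
      ∃ λ K → IsBoundary m K (p K) × SegInSide m c x true K (p K) × SegInSide m y y′ false K (p K)
    boundary-in-quadrant {y = y} refl refl c-y-x x-c-y′ =
      found (boundary-before 0<Y (subst (pos y <_) (sym q-origin) Y<X)
                                 (subst₂ _<_ (sym q-origin) (sym (q-pos y)) X<Y′))
      where
      0<Y×Y<X : 0 < pos y × pos y < pos (p c)
      0<Y×Y<X = between-from-zero (subst (λ o → Between o (pos (p c)) (pos y)) pos-centre (inArc⇒between c-y-x))
      0<Y : 0 < pos y
      0<Y = proj₁ 0<Y×Y<X
      Y<X : pos y < pos (p c)
      Y<X = proj₂ 0<Y×Y<X
      X<Y′ : pos (p c) < pos (p y)
      X<Y′ = between-to-zero (subst (λ o → Between (pos (p c)) o (pos (p y))) pos-centre (inArc⇒between x-c-y′))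
      found : BoundaryBetween 0 (pos y) →
              ∃ λ K → IsBoundary m K (p K) × SegInSide m c (p c) true K (p K) × SegInSide m y (p y) false K (p K)
      found (k , 0<k , sk<Y , qk≡sk) =
        vertex k , boundary-at k<n qk≡sk ,
        segment-at pos-centre refl k<n qk≡sk (edge-between 0<k (<-trans sk<Y Y<X)) ,
        segment-at refl refl k<n qk≡sk (edge-before sk<Y (<-trans Y<X X<Y′))
        where
        k<n : k < n
        k<n = <-trans (n<1+n k) (<-trans sk<Y (pos<n y))

  boundary-on-each-side : (i : V m) → IsInterior m i (p i) → (σ : Bool) →
    ∃ λ k → IsBoundary m k (p k) × SegInSide m i (p i) σ k (p k)
  boundary-on-each-side i interior true =
    Centred.boundary-beside i refl (interior⇒¬adjacent interior ∘ inj₁)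
  boundary-on-each-side i interior false =
    Centred.boundary-beside (p i) (involutive M i) (interior⇒¬adjacent interior ∘ inj₂)

  crossing-quadrants : ∀ {a a′ b b′} → p a ≡ a′ → p b ≡ b′ → InArc m a a′ b → InArc m a′ a b′ →
    (σ τ : Bool) → ∃ λ k → IsBoundary m k (p k) × SegInSide m a a′ σ k (p k) × SegInSide m b b′ τ k (p k)
  crossing-quadrants {a} pa pb a-b-a′ a′-b′-a true false =
    Centred.boundary-in-quadrant a pa pb a-b-a′ a′-b′-a
  crossing-quadrants {a′ = a′} pa pb a-b-a′ a′-b′-a false true =
    Centred.boundary-in-quadrant a′ (partner-of pa) (partner-of pb) a′-b′-a a-b-a′
  crossing-quadrants {b = b} pa pb a-b-a′ a′-b′-a true true with crossing-swap a-b-a′ a′-b′-a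
  ... | b-a′-b′ , b′-a-b =
    map₂ (map₂ swap) (Centred.boundary-in-quadrant b pb (partner-of pa) b-a′-b′ b′-a-b)
  crossing-quadrants {b′ = b′} pa pb a-b-a′ a′-b′-a false false with crossing-swap a-b-a′ a′-b′-a
  ... | b-a′-b′ , b′-a-b =
    map₂ (map₂ swap) (Centred.boundary-in-quadrant b′ (partner-of pb) pa b′-a-b b-a′-b′)

  boundary-in-each-quadrant : (i j : V m) → Cross m i (p i) j (p j) → (σ τ : Bool) →
    ∃ λ k → IsBoundary m k (p k) × SegInSide m i (p i) σ k (p k) × SegInSide m j (p j) τ k (p k)
  boundary-in-each-quadrant i j (inj₁ (i-j-pi , pi-pj-i)) σ τ =
    crossing-quadrants refl refl i-j-pi pi-pj-i σ τ
  boundary-in-each-quadrant i j (inj₂ (pi-j-i , i-pj-pi)) true τ =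
    crossing-quadrants (involutive M i) refl pi-j-i i-pj-pi false τ
  boundary-in-each-quadrant i j (inj₂ (pi-j-i , i-pj-pi)) false τ =
    crossing-quadrants (involutive M i) refl pi-j-i i-pj-pi true τ

lemma2 : (m : ℕ) (M : PerfectMatching m) → SemiSimple m M →
    ((i : V m) → IsInterior m i (partner M i) →
      (σ : Bool) →
        ∃ λ k → IsBoundary m k (partner M k) ×
                SegInSide m i (partner M i) σ k (partner M k))
    ×
    ((i j : V m) → Cross m i (partner M i) j (partner M j) →
      (σ τ : Bool) →
        ∃ λ k → IsBoundary m k (partner M k) ×
                SegInSide m i (partner M i) σ k (partner M k) ×
                SegInSide m j (partner M j) τ k (partner M k))
lemma2 zero    M semi-simple = (λ ()) , (λ ())
lemma2 (suc m) M semi-simple =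
  Matching.boundary-on-each-side M semi-simple , Matching.boundary-in-each-quadrant M semi-simple
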